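{- Let $G$ be an interval graph and let $I$ and $J$ be two independent sets of $G$ of size $k\geq 2$. Let $u$ be the leftmost vertex of $I$ and $v$ the leftmost vertex of $J$. Then $I$ and $J$ are in the same connected component of $TS_k(G)$ if and only if both of the following hold: (1) $LM(I,G)=LM(J,G)$; (2) letting $a=LM(I,G)$, the independent sets $I\setminus\{u\}$ and $J\setminus\{v\}$ are in the same connected component of $TS_{k-1}(G_a)$.
   Context: Each vertex $x$ of $G$ is represented by an interval with left extremity $l(x)$ and right extremity $r(x)$, all extremities pairwise distinct; vertices are adjacent iff their intervals intersect. $x\prec_r y$ means $r(x)<r(y)$. For a vertex $a$, $G_a$ is the subgraph induced by the vertices $x$ with $l(x)>r(a)$. The leftmost vertex $lm(K)$ of an independent set $K$ is its vertex with smallest left (equivalently right) extremity. $TS_k(H)$ is the graph whose vertices are the independent sets of $H$ of size $k$, two sets $A,B$ being adjacent if $A\setminus B=\{x\}$, $B\setminus A=\{y\}$ and $xy$ is an edge. For an independent set $I$ of size $k$ in $H$, $LM(I,H)$ is the $\prec_r$-minimum of $lm(K)$ over all $K$ in the connected component of $I$ in $TS_k(H)$. -}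

module Defs where

open import Data.Nat using (ℕ; _<_; _≤_; _∸_)
open import Data.Fin using (Fin)
open import Data.Fin.Subset using (Subset; _∈_; _∉_; ∣_∣; _-_)
open import Data.Product using (Σ; ∃; _×_; _,_)
open import Relation.Binary.PropositionalEquality using (_≡_; _≢_)
open import Relation.Nullary using (¬_)
open import Relation.Binary.Construct.Closure.ReflexiveTransitive using (Star)
open import Function.Bundles using (_⇔_)

-- An interval model on vertex set Fin n: vertex x is the interval [l x, r x],
-- with all 2n extremities pairwise distinct.
record IntervalGraph (n : ℕ) : Set where
  field
    l : Fin n → ℕ
    r : Fin n → ℕ
    l<r    : ∀ x → l x < r x
    l-inj  : ∀ x y → l x ≡ l y → x ≡ y
    r-inj  : ∀ x y → r x ≡ r y → x ≡ y
    l≢r    : ∀ x y → l x ≢ r y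

module _ {n : ℕ} (G : IntervalGraph n) where
  open IntervalGraph G

  Adj : Fin n → Fin n → Set
  Adj x y = x ≢ y × (l x ≤ r y × l y ≤ r x)

  -- An induced subgraph H of G is given by its vertex set (a predicate).
  VSet : Set₁
  VSet = Fin n → Set

  Whole : VSet
  Whole _ = Data.Unit.⊤
    where import Data.Unit

  After : Fin n → VSet
  After a x = r a < l x

  IndepOfSize : VSet → ℕ → Subset n → Set
  IndepOfSize H k A =
    (∀ x → x ∈ A → H x) ×
    (∀ x y → x ∈ A → y ∈ A → ¬ Adj x y) ×
    ∣ A ∣ ≡ k

  Slide : Subset n → Subset n → Set
  Slide A B = Σ (Fin n) λ x → Σ (Fin n) λ y →
    x ∈ A × x ∉ B × y ∈ B × y ∉ A × Adj x y ×
    (∀ z → z ≢ x → z ≢ y → (z ∈ A ⇔ z ∈ B))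

  TSEdge : VSet → ℕ → Subset n → Subset n → Set
  TSEdge H k A B = IndepOfSize H k A × IndepOfSize H k B × Slide A B

  SameComp : VSet → ℕ → Subset n → Subset n → Set
  SameComp H k = Star (TSEdge H k)

  IsLeftmost : Subset n → Fin n → Set
  IsLeftmost K x = x ∈ K × (∀ y → y ∈ K → r x ≤ r y)

  IsLM : VSet → ℕ → Subset n → Fin n → Set
  IsLM H k I a =
    (∃ λ K → SameComp H k I K × IsLeftmost K a) ×
    (∀ K b → SameComp H k I K → IsLeftmost K b → r a ≤ r b)

-- Sliding a vertex of an independent set either moves its leftmost vertex w,
-- and then the rest of the set is unchanged, or it slides a vertex of the rest,
-- which lies entirely to the right of w and hence inside G_a for a = LM.  So
-- along a component of TS_k(G) the "tails" K ∖ lm(K) stay in one component of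
-- TS_{k-1}(G_a), and LM is an invariant of the component.  Conversely a path of
-- TS_{k-1}(G_a) between tails lifts to TS_k(G) by adding a back, since a is
-- disjoint from every interval of G_a.
module Submission where

open import Defs
open import Data.Nat using (ℕ; suc; _≤_; _<_; _∸_; _≤?_; pred; s≤s)
open import Data.Nat.Properties using (≤-refl; ≤-trans; <-trans; <-≤-trans; ≤-<-trans; <⇒≤; ≤-antisym; <-irrefl; ≰⇒>; ≤∧≢⇒<)
open import Data.Fin using (Fin; zero; suc; _≟_)
open import Data.Fin.Subset using (Subset; _∈_; _∉_; ∣_∣; _-_; _─_; _∪_; ⁅_⁆; inside; outside)
open import Data.Fin.Subset.Properties
  using (∪-identityʳ; x∈⁅x⁆; x∈⁅y⁆⇒x≡y; x∈p∪q⁻; x∈p∪q⁺; p─q⊆p; x∈p∧x≢y⇒x∈p-y; ⊆-antisym)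
open import Data.Product using (Σ; _×_; _,_; proj₁)
open import Data.Sum using (_⊎_; inj₁; inj₂)
open import Data.Unit using (tt)
open import Data.Vec using (_∷_; here; there)
open import Function using (_∘_)
open import Function.Bundles using (_⇔_; mk⇔; Equivalence)
open import Relation.Binary.PropositionalEquality using (_≡_; _≢_; refl; sym; trans; cong; subst; subst₂)
open import Relation.Binary.Construct.Closure.ReflexiveTransitive using (ε; _◅_; _◅◅_; reverse)
open import Relation.Nullary using (¬_; yes; no; contradiction)

private variable
  n k : ℕ
  x y : Fin n

x∈p─q⇒x∉q : ∀ (p q : Subset n) → x ∈ p ─ q → x ∉ q
x∈p─q⇒x∉q (inside ∷ p) (outside ∷ q) here = λ ()
x∈p─q⇒x∉q (_ ∷ p) (_ ∷ q) (there x∈p─q) (there x∈q) = x∈p─q⇒x∉q p q x∈p─q x∈q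

x∈p-y⇒x≢y : ∀ (p : Subset n) → x ∈ p - y → x ≢ y
x∈p-y⇒x≢y {x = x} p x∈p-y refl = x∈p─q⇒x∉q p ⁅ x ⁆ x∈p-y (x∈⁅x⁆ x)

x∈p∪⁅y⁆⁻ : ∀ (p : Subset n) → x ∈ p ∪ ⁅ y ⁆ → x ∈ p ⊎ x ≡ y
x∈p∪⁅y⁆⁻ {y = y} p x∈ with x∈p∪q⁻ p ⁅ y ⁆ x∈
... | inj₁ x∈p   = inj₁ x∈p
... | inj₂ x∈⁅y⁆ = inj₂ (x∈⁅y⁆⇒x≡y y x∈⁅y⁆)

x∈p-y-mono : ∀ (p : Subset n) {q} → (x ∈ p → x ∈ q) → x ∈ p - y → x ∈ q - y
x∈p-y-mono {y = y} p p⇒q x∈ = x∈p∧x≢y⇒x∈p-y (p⇒q (p─q⊆p p ⁅ y ⁆ x∈)) (x∈p-y⇒x≢y p x∈)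

x∈p∪⁅y⁆-mono : ∀ (p : Subset n) {q} → (x ∈ p → x ∈ q) → x ∈ p ∪ ⁅ y ⁆ → x ∈ q ∪ ⁅ y ⁆
x∈p∪⁅y⁆-mono p p⇒q x∈ with x∈p∪⁅y⁆⁻ p x∈
... | inj₁ x∈p  = x∈p∪q⁺ (inj₁ (p⇒q x∈p))
... | inj₂ refl = x∈p∪q⁺ (inj₂ (x∈⁅x⁆ _))

∣p∪⁅x⁆∣≡1+∣p∣ : ∀ (p : Subset n) → x ∉ p → ∣ p ∪ ⁅ x ⁆ ∣ ≡ suc ∣ p ∣
∣p∪⁅x⁆∣≡1+∣p∣ {x = zero}  (inside  ∷ p) x∉p = contradiction here x∉p
∣p∪⁅x⁆∣≡1+∣p∣ {x = zero}  (outside ∷ p) x∉p = cong (suc ∘ ∣_∣) (∪-identityʳ p)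
∣p∪⁅x⁆∣≡1+∣p∣ {x = suc x} (inside  ∷ p) x∉p = cong suc (∣p∪⁅x⁆∣≡1+∣p∣ p (x∉p ∘ there))
∣p∪⁅x⁆∣≡1+∣p∣ {x = suc x} (outside ∷ p) x∉p = ∣p∪⁅x⁆∣≡1+∣p∣ p (x∉p ∘ there)

p-x∪⁅x⁆≡p : ∀ (p : Subset n) → x ∈ p → (p - x) ∪ ⁅ x ⁆ ≡ p
p-x∪⁅x⁆≡p {x = x} p x∈p = ⊆-antisym ⊆p p⊆
  where
  ⊆p : ∀ {z} → z ∈ (p - x) ∪ ⁅ x ⁆ → z ∈ p
  ⊆p z∈ with x∈p∪⁅y⁆⁻ (p - x) z∈
  ... | inj₁ z∈p-x = p─q⊆p p ⁅ x ⁆ z∈p-x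
  ... | inj₂ refl  = x∈p
  p⊆ : ∀ {z} → z ∈ p → z ∈ (p - x) ∪ ⁅ x ⁆
  p⊆ {z} z∈p with z ≟ x
  ... | yes refl = x∈p∪q⁺ (inj₂ (x∈⁅x⁆ x))
  ... | no z≢x   = x∈p∪q⁺ (inj₁ (x∈p∧x≢y⇒x∈p-y z∈p z≢x))

∣p-x∣+1≡∣p∣ : ∀ (p : Subset n) → x ∈ p → suc ∣ p - x ∣ ≡ ∣ p ∣
∣p-x∣+1≡∣p∣ {x = x} p x∈p =
  trans (sym (∣p∪⁅x⁆∣≡1+∣p∣ (p - x) (λ x∈p-x → x∈p-y⇒x≢y p x∈p-x refl)))
        (cong ∣_∣ (p-x∪⁅x⁆≡p p x∈p))

module _ {n : ℕ} (G : IntervalGraph n) where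
  open IntervalGraph G

  private variable
    a u w : Fin n
    A B S T : Subset n
    H H′ : VSet G

  -- Slide G A B is definitionally Σ x Σ y (SlideVia A B x y).
  SlideVia : Subset n → Subset n → Fin n → Fin n → Set
  SlideVia A B x y = x ∈ A × x ∉ B × y ∈ B × y ∉ A × Adj G x y ×
                     (∀ z → z ≢ x → z ≢ y → (z ∈ A ⇔ z ∈ B))

  Adj-sym : Adj G x y → Adj G y x
  Adj-sym (x≢y , lx≤ry , ly≤rx) = x≢y ∘ sym , ly≤rx , lx≤ry

  Slide-sym : Slide G A B → Slide G B A
  Slide-sym (x , y , x∈A , x∉B , y∈B , y∉A , xy , rest) =
    y , x , y∈B , y∉A , x∈A , x∉B , Adj-sym xy ,
    λ z z≢y z≢x → let z∈A⇔z∈B = rest z z≢x z≢y in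
      mk⇔ (Equivalence.from z∈A⇔z∈B) (Equivalence.to z∈A⇔z∈B)

  SameComp-sym : SameComp G H k A B → SameComp G H k B A
  SameComp-sym = reverse (λ (iA , iB , s) → iB , iA , Slide-sym s)

  nonadjacent⇒before : x ≢ y → ¬ Adj G x y → r x < r y → r x < l y
  nonadjacent⇒before {x} {y} x≢y ¬xy rx<ry with l y ≤? r x
  ... | yes ly≤rx = contradiction (x≢y , ≤-trans (<⇒≤ (l<r x)) (<⇒≤ rx<ry) , ly≤rx) ¬xy
  ... | no ly≰rx  = ≰⇒> ly≰rx

  leftmost-unique : IsLeftmost G A u → IsLeftmost G A w → u ≡ w
  leftmost-unique (u∈A , u-min) (w∈A , w-min) = r-inj _ _ (≤-antisym (u-min _ w∈A) (w-min _ u∈A))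

  leftmost-before : IndepOfSize G H k A → IsLeftmost G A w → x ∈ A → x ≢ w → r w < l x
  leftmost-before (_ , indep , _) (w∈A , w-min) x∈A x≢w =
    nonadjacent⇒before (x≢w ∘ sym) (indep _ _ w∈A x∈A)
      (≤∧≢⇒< (w-min _ x∈A) (x≢w ∘ sym ∘ r-inj _ _))

  After-irrefl : ¬ After G a a
  After-irrefl {a} ra<la = <-irrefl refl (<-trans (l<r a) ra<la)

  After-antitone : r a ≤ r w → After G w x → After G a x
  After-antitone = ≤-<-trans

  IndepOfSize-mono : (∀ {x} → H x → H′ x) → IndepOfSize G H k A → IndepOfSize G H′ k A
  IndepOfSize-mono H⊆H′ (A⊆H , indep , size) = (λ x x∈A → H⊆H′ (A⊆H x x∈A)) , indep , size

  TSEdge-mono : (∀ {x} → H x → H′ x) → TSEdge G H k A B → TSEdge G H′ k A B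
  TSEdge-mono H⊆H′ (iA , iB , s) = IndepOfSize-mono H⊆H′ iA , IndepOfSize-mono H⊆H′ iB , s

  tail-independent : IndepOfSize G (Whole G) k A → IsLeftmost G A w →
                     IndepOfSize G (After G w) (k ∸ 1) (A - w)
  tail-independent {A = A} {w} iA@(_ , indep , size) lmA@(w∈A , _) =
      (λ x x∈ → leftmost-before iA lmA (p─q⊆p A ⁅ w ⁆ x∈) (x∈p-y⇒x≢y A x∈))
    , (λ x y x∈ y∈ → indep x y (p─q⊆p A ⁅ w ⁆ x∈) (p─q⊆p A ⁅ w ⁆ y∈))
    , cong pred (trans (∣p-x∣+1≡∣p∣ A w∈A) size)

  slideVia-remove : SlideVia A B x y → w ≢ x → w ≢ y → SlideVia (A - w) (B - w) x y
  slideVia-remove {A} {B} {x} {y} {w} (x∈A , x∉B , y∈B , y∉A , xy , rest) w≢x w≢y =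
      x∈p∧x≢y⇒x∈p-y x∈A (w≢x ∘ sym) , x∉B ∘ p─q⊆p B ⁅ w ⁆
    , x∈p∧x≢y⇒x∈p-y y∈B (w≢y ∘ sym) , y∉A ∘ p─q⊆p A ⁅ w ⁆
    , xy
    , λ z z≢x z≢y → mk⇔ (x∈p-y-mono A (Equivalence.to (rest z z≢x z≢y)))
                        (x∈p-y-mono B (Equivalence.from (rest z z≢x z≢y)))

  slideVia-insert : SlideVia A B x y → a ≢ x → a ≢ y → SlideVia (A ∪ ⁅ a ⁆) (B ∪ ⁅ a ⁆) x y
  slideVia-insert {A} {B} {x} {y} {a} (x∈A , x∉B , y∈B , y∉A , xy , rest) a≢x a≢y =
      x∈p∪q⁺ (inj₁ x∈A) , avoid B x∉B (a≢x ∘ sym)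
    , x∈p∪q⁺ (inj₁ y∈B) , avoid A y∉A (a≢y ∘ sym)
    , xy
    , λ z z≢x z≢y → mk⇔ (x∈p∪⁅y⁆-mono A (Equivalence.to (rest z z≢x z≢y)))
                        (x∈p∪⁅y⁆-mono B (Equivalence.from (rest z z≢x z≢y)))
    where
    avoid : ∀ C {z} → z ∉ C → z ≢ a → z ∉ C ∪ ⁅ a ⁆
    avoid C z∉C z≢a z∈ with x∈p∪⁅y⁆⁻ C z∈
    ... | inj₁ z∈C = z∉C z∈C
    ... | inj₂ z≡a = z≢a z≡a

  -- Moving the leftmost vertex w to y: y is to the left of every z ≠ y of B, because
  -- y meets w, which ends before z starts, and y does not meet z.
  slide-of-leftmost : IndepOfSize G (Whole G) k A → IndepOfSize G (Whole G) k B →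
                      SlideVia A B w y → IsLeftmost G A w → IsLeftmost G B y × A - w ≡ B - y
  slide-of-leftmost {A = A} {B} {w} {y} iA (_ , indepB , _)
                    (w∈A , w∉B , y∈B , y∉A , (_ , _ , ly≤rw) , rest) lmA =
    (y∈B , y-min) , ⊆-antisym A-w⊆B-y B-y⊆A-w
    where
    y-min : ∀ z → z ∈ B → r y ≤ r z
    y-min z z∈B with z ≟ y | z ≟ w
    ... | yes refl | _        = ≤-refl
    ... | no _     | yes refl = contradiction z∈B w∉B
    ... | no z≢y   | no z≢w   = <⇒≤ (<-trans (nonadjacent⇒before (z≢y ∘ sym) ¬yz ry<rz) (l<r z))
      where
      rw<lz : r w < l z
      rw<lz = leftmost-before iA lmA (Equivalence.from (rest z z≢w z≢y) z∈B) z≢w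
      ¬yz : ¬ Adj G y z
      ¬yz = indepB y z y∈B z∈B
      ry<rz : r y < r z
      ry<rz with l z ≤? r y
      ... | yes lz≤ry = contradiction (z≢y ∘ sym , ≤-trans ly≤rw (<⇒≤ (<-trans rw<lz (l<r z))) , lz≤ry) ¬yz
      ... | no lz≰ry  = <-trans (≰⇒> lz≰ry) (l<r z)
    A-w⊆B-y : ∀ {z} → z ∈ A - w → z ∈ B - y
    A-w⊆B-y {z} z∈ with z ≟ y
    ... | yes refl = contradiction (p─q⊆p A ⁅ w ⁆ z∈) y∉A
    ... | no z≢y   =
      x∈p∧x≢y⇒x∈p-y (Equivalence.to (rest z (x∈p-y⇒x≢y A z∈) z≢y) (p─q⊆p A ⁅ w ⁆ z∈)) z≢y
    B-y⊆A-w : ∀ {z} → z ∈ B - y → z ∈ A - w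
    B-y⊆A-w {z} z∈ with z ≟ w
    ... | yes refl = contradiction (p─q⊆p B ⁅ y ⁆ z∈) w∉B
    ... | no z≢w   =
      x∈p∧x≢y⇒x∈p-y (Equivalence.from (rest z z≢w (x∈p-y⇒x≢y B z∈)) (p─q⊆p B ⁅ y ⁆ z∈)) z≢w

  slide-past-leftmost : IndepOfSize G H k A → SlideVia A B x y → IsLeftmost G A w → x ≢ w →
                        IsLeftmost G B w × SlideVia (A - w) (B - w) x y
  slide-past-leftmost {x = x} {y} {w} iA s@(x∈A , x∉B , y∈B , y∉A , (_ , lx≤ry , _) , rest)
                      lmA@(w∈A , w-min) x≢w =
    (w∈B , w-min′) , slideVia-remove s (x≢w ∘ sym) w≢y
    where
    w≢y : w ≢ y
    w≢y w≡y = y∉A (subst (_∈ _) w≡y w∈A)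
    w∈B : w ∈ _
    w∈B = Equivalence.to (rest w (x≢w ∘ sym) w≢y) w∈A
    w-min′ : ∀ z → z ∈ _ → r w ≤ r z
    w-min′ z z∈B with z ≟ y | z ≟ x
    ... | yes refl | _        = <⇒≤ (<-≤-trans (leftmost-before iA lmA x∈A x≢w) lx≤ry)
    ... | no _     | yes refl = contradiction z∈B x∉B
    ... | no z≢y   | no z≢x   = w-min z (Equivalence.from (rest z z≢x z≢y) z∈B)

  TSEdge-tail : TSEdge G (Whole G) k A B → IsLeftmost G A w →
                Σ (Fin n) λ w′ → IsLeftmost G B w′ ×
                  (A - w ≡ B - w′ ⊎ (w′ ≡ w × TSEdge G (After G w) (k ∸ 1) (A - w) (B - w)))
  TSEdge-tail {w = w} (iA , iB , (x , y , s)) lmA with x ≟ w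
  ... | yes refl = let lmB , tail≡ = slide-of-leftmost iA iB s lmA in y , lmB , inj₁ tail≡
  ... | no x≢w   = let lmB , s′ = slide-past-leftmost iA s lmA x≢w in
    w , lmB , inj₂ (refl , tail-independent iA lmA , tail-independent iB lmB , x , y , s′)

  tails-connected : (∀ T b → SameComp G (Whole G) k A T → IsLeftmost G T b → r a ≤ r b) →
                    SameComp G (Whole G) k A B → IsLeftmost G A u → IsLeftmost G B w →
                    SameComp G (After G a) (k ∸ 1) (A - u) (B - w)
  tails-connected {a = a} bound ε lmA lmB rewrite leftmost-unique lmA lmB = ε
  tails-connected {a = a} bound (e ◅ path) lmA lmB with TSEdge-tail e lmA
  ... | u′ , lmA′ , inj₁ tail≡ =
    subst (λ S → SameComp G (After G a) _ S _) (sym tail≡)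
      (tails-connected (λ T b → bound T b ∘ (e ◅_)) path lmA′ lmB)
  ... | _ , lmA′ , inj₂ (refl , e′) =
    TSEdge-mono (After-antitone (bound _ _ ε lmA)) e′
      ◅ tails-connected (λ T b → bound T b ∘ (e ◅_)) path lmA′ lmB

  IndepOfSize-insert : IndepOfSize G (After G a) k S → IndepOfSize G (Whole G) (suc k) (S ∪ ⁅ a ⁆)
  IndepOfSize-insert {a} {S = S} (S⊆After , indep , size) =
    (λ _ _ → tt) , indep′ , trans (∣p∪⁅x⁆∣≡1+∣p∣ S (After-irrefl ∘ S⊆After a)) (cong suc size)
    where
    a-isolated : ∀ z → z ∈ S → ¬ Adj G a z
    a-isolated z z∈S (_ , _ , lz≤ra) = <-irrefl refl (<-≤-trans (S⊆After z z∈S) lz≤ra)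
    indep′ : ∀ x y → x ∈ S ∪ ⁅ a ⁆ → y ∈ S ∪ ⁅ a ⁆ → ¬ Adj G x y
    indep′ x y x∈ y∈ with x∈p∪⁅y⁆⁻ S x∈ | x∈p∪⁅y⁆⁻ S y∈
    ... | inj₁ x∈S | inj₁ y∈S = indep x y x∈S y∈S
    ... | inj₁ x∈S | inj₂ refl = a-isolated x x∈S ∘ Adj-sym
    ... | inj₂ refl | inj₁ y∈S = a-isolated y y∈S
    ... | inj₂ refl | inj₂ refl = λ (a≢a , _) → a≢a refl

  SameComp-insert : SameComp G (After G a) k S T → SameComp G (Whole G) (suc k) (S ∪ ⁅ a ⁆) (T ∪ ⁅ a ⁆)
  SameComp-insert ε = ε
  SameComp-insert {a} (e ◅ path) = edge-insert e ◅ SameComp-insert path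
    where
    edge-insert : TSEdge G (After G a) _ S T → TSEdge G (Whole G) _ (S ∪ ⁅ a ⁆) (T ∪ ⁅ a ⁆)
    edge-insert (iS@(S⊆After , _) , iT@(T⊆After , _) , (x , y , s@(x∈S , _ , y∈T , _))) =
        IndepOfSize-insert iS , IndepOfSize-insert iT
      , x , y , slideVia-insert s (λ { refl → After-irrefl (S⊆After a x∈S) })
                                  (λ { refl → After-irrefl (T⊆After a y∈T) })

lemma20 : {n : ℕ} (G : IntervalGraph n) (k : ℕ) → 2 ≤ k →
    (I J : Subset n) → IndepOfSize G (Whole G) k I → IndepOfSize G (Whole G) k J →
    (u v : Fin n) → IsLeftmost G I u → IsLeftmost G J v →
    (a b : Fin n) → IsLM G (Whole G) k I a → IsLM G (Whole G) k J b →
    SameComp G (Whole G) k I J ⇔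
    (a ≡ b × SameComp G (After G a) (k ∸ 1) (I - u) (J - v))
lemma20 G (suc k) (s≤s _) I J _ _ u v lmI lmJ a b ((K , I~K , lmK) , minI) ((K′ , J~K′ , lmK′) , minJ) =
  mk⇔ to from
  where
  open IntervalGraph G
  to : SameComp G (Whole G) (suc k) I J → a ≡ b × SameComp G (After G a) k (I - u) (J - v)
  to I~J = r-inj a b (≤-antisym (minI K′ b (I~J ◅◅ J~K′) lmK′)
                                (minJ K a (SameComp-sym G I~J ◅◅ I~K) lmK))
         , tails-connected G minI I~J lmI lmJ
  from : a ≡ b × SameComp G (After G a) k (I - u) (J - v) → SameComp G (Whole G) (suc k) I J
  from (refl , tails) = I~K ◅◅ K~K′ ◅◅ SameComp-sym G J~K′
    where
    tailK~tailK′ : SameComp G (After G a) k (K - a) (K′ - a)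
    tailK~tailK′ = SameComp-sym G (tails-connected G minI I~K lmI lmK)
                   ◅◅ tails ◅◅ tails-connected G minJ J~K′ lmJ lmK′
    K~K′ : SameComp G (Whole G) (suc k) K K′
    K~K′ = subst₂ (SameComp G (Whole G) (suc k)) (p-x∪⁅x⁆≡p K (proj₁ lmK)) (p-x∪⁅x⁆≡p K′ (proj₁ lmK′))
                  (SameComp-insert G tailK~tailK′)
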